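{- Let $(a_n)_{n=1}^\infty$ be a non-decreasing sequence of positive integers with $a_1\geqslant 2$ and $a_n\to\infty$. Then there exist $\theta\in(0,1)$ and a sequence of positive integers $(b_n)_{n=1}^\infty$ such that $\sum_{n=1}^\infty\frac1{b_n}=\theta$ and, for every $n\geqslant 1$, $a_n=G\left(\theta-\sum_{i=1}^{n-1}\frac1{b_i}\right)$.
   Context: For $x\in(0,1]$, $G(x)=\lfloor 1/x\rfloor+1$, i.e. the unique integer $a\geqslant 2$ with $\frac1a<x\leqslant\frac{1}{a-1}$. Empty sums are $0$. -}

module Defs where

open import Data.Nat using (ℕ; zero; suc)
open import Data.Integer using (+_)
open import Data.Rational using (ℚ; 0ℚ; _/_; _+_)

-- recip k = 1/k for k ≥ 1 (and 0 for k = 0, never used under the hypotheses)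
recip : ℕ → ℚ
recip zero    = 0ℚ
recip (suc k) = (+ 1) / suc k

-- partial b k = Σ_{i<k} 1/b_i   (0-based indexing: b 0 is the paper's b_1)
partial : (ℕ → ℕ) → ℕ → ℚ
partial b zero    = 0ℚ
partial b (suc k) = partial b k + recip (b k)

{-# OPTIONS --safe #-}
module Submission where

-- Write A_n = a_n − 1; every tail Σ_{i≥n} 1/b_i has to lie in (1/a_n, 1/A_n].
-- Upper bound: with S_k = partial b k, the b_i are chosen so that S_k + budget A_k k never
-- increases, where budget A i = 1/A − 1/c + 1/(i+1+c) lies in [0, 1/A) for a reserve c = slack A.
-- While a_{i+1} = a_i the budget is spent through 1/(e(e+1)) = 1/e − 1/(e+1), e = i+1+c.
-- At a jump a_{i+1} = a_i + D one takes b_i = a_i + ⌊A²/D⌋, the least b with 1/b < 1/A − 1/(A+D);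
-- the reserve 1/c pays for the rounding, so it is taken below 1/(2 a_i A), which suffices when
-- D ≥ 2 a_i A, and below 1/(P(P+1)) with P = A(A+D), which suffices for smaller D.
-- Lower bound: S_i + 1/a_i never decreases and gains 1/(b_n a_n a_{n+1}) at step n, which exceeds
-- 1/a_k as soon as a_k > b_n a_n a_{n+1}; this happens since a is unbounded.

open import Defs
open import Data.Nat
  using (ℕ; zero; suc; _+_; _*_; _∸_; z≤n; s≤s; _≤′_; ≤′-refl; ≤′-step)
  using (NonZero; >-nonZero; >-nonZero⁻¹)
  renaming (_≤_ to _≤ₙ_; _<_ to _<ₙ_)
import Data.Nat.Properties as ℕ
open import Data.Nat.DivMod using (_/_; m≡m%n+[m/n]*n; m%n<n; m/n*n≤m)
open import Data.Nat.Coprimality as Coprime using ()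
open import Data.Integer using (+_)
import Data.Integer as ℤ using (_+_; _≤_; _<_; +≤+; +<+)
import Data.Integer.Properties as ℤ
open import Data.Rational using (ℚ; mkℚ; 0ℚ; 1ℚ; _≤_; _<_; _-_)
import Data.Rational as ℚ using (_+_; _*_; -_; _/_; _≟_; *≤*; *<*)
import Data.Rational.Properties as ℚ
open import Data.Product using (∃; _×_; _,_)
open import Data.Sum using (_⊎_; inj₁; inj₂)
open import Function using (flip)
open import Relation.Binary using (Rel; Reflexive; Transitive)
open import Relation.Binary.PropositionalEquality
  using (_≡_; refl; sym; trans; cong; cong₂; subst; subst₂; module ≡-Reasoning)
open import Relation.Nullary.Decidable using (dec⇒maybe)
import Tactic.RingSolver.Core.AlmostCommutativeRing as ACR
open import Tactic.RingSolver using (solve-∀)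
open import Data.Nat.Tactic.RingSolver using () renaming (ring to ℕ-ring)

ℚ-ring : ACR.AlmostCommutativeRing _ _
ℚ-ring = ACR.fromCommutativeRing ℚ.+-*-commutativeRing (λ p → dec⇒maybe (0ℚ ℚ.≟ p))

p+q-p≡q : ∀ p q → p ℚ.+ q - p ≡ q
p+q-p≡q = solve-∀ ℚ-ring

p-q+q≡p : ∀ p q → p - q ℚ.+ q ≡ p
p-q+q≡p = solve-∀ ℚ-ring

p+[q+r]≡q+[p+r] : ∀ p q r → p ℚ.+ (q ℚ.+ r) ≡ q ℚ.+ (p ℚ.+ r)
p+[q+r]≡q+[p+r] = solve-∀ ℚ-ring

p≤p+q : ∀ p {q} → 0ℚ ≤ q → p ≤ p ℚ.+ q
p≤p+q p 0≤q = subst (_≤ p ℚ.+ _) (ℚ.+-identityʳ p) (ℚ.+-monoʳ-≤ p 0≤q)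

p≤q+r⇒p-q≤r : ∀ {p q r} → p ≤ q ℚ.+ r → p - q ≤ r
p≤q+r⇒p-q≤r {p} {q} {r} h = subst (p - q ≤_) (p+q-p≡q q r) (ℚ.+-monoˡ-≤ (ℚ.- q) h)

p+q≤r⇒q≤r-p : ∀ {p q r} → p ℚ.+ q ≤ r → q ≤ r - p
p+q≤r⇒q≤r-p {p} {q} {r} h = subst (_≤ r - p) (p+q-p≡q p q) (ℚ.+-monoˡ-≤ (ℚ.- p) h)

p+q<r⇒q<r-p : ∀ p {q r} → p ℚ.+ q < r → q < r - p
p+q<r⇒q<r-p p {q} {r} h = subst (_< r - p) (p+q-p≡q p q) (ℚ.+-monoˡ-< (ℚ.- p) h)

+-cancelʳ-< : ∀ {p q} r → p ℚ.+ r < q ℚ.+ r → p < q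
+-cancelʳ-< {p} {q} r h = subst₂ _<_ (p+q-q≡p p r) (p+q-q≡p q r) (ℚ.+-monoˡ-< (ℚ.- r) h)
  where
  p+q-q≡p : ∀ p q → p ℚ.+ q - q ≡ p
  p+q-q≡p = solve-∀ ℚ-ring

ι : ℕ → ℚ
ι n = mkℚ (+ n) 0 (Coprime.sym (Coprime.1-coprimeTo n))

ι-+ : ∀ m n → ι m ℚ.+ ι n ≡ ι (m + n)
ι-+ m n = trans (cong (ℚ._/ 1) (trans (cong₂ ℤ._+_ (ℤ.*-identityʳ (+ m)) (ℤ.*-identityʳ (+ n)))
                                      (sym (ℤ.pos-+ m n))))
                (ℚ.normalize-coprime _)

ι-* : ∀ m n → ι m ℚ.* ι n ≡ ι (m * n)
ι-* m n = trans (cong (ℚ._/ 1) (sym (ℤ.pos-* m n))) (ℚ.normalize-coprime _)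

ι-mono-≤ : ∀ {m n} → m ≤ₙ n → ι m ≤ ι n
ι-mono-≤ {m} {n} m≤n =
  ℚ.*≤* (subst₂ ℤ._≤_ (sym (ℤ.*-identityʳ (+ m))) (sym (ℤ.*-identityʳ (+ n))) (ℤ.+≤+ m≤n))

ι-mono-< : ∀ {m n} → m <ₙ n → ι m < ι n
ι-mono-< {m} {n} m<n =
  ℚ.*<* (subst₂ ℤ._<_ (sym (ℤ.*-identityʳ (+ m))) (sym (ℤ.*-identityʳ (+ n))) (ℤ.+<+ m<n))

recip-inverseˡ : ∀ k → recip (suc k) ℚ.* ι (suc k) ≡ 1ℚ
recip-inverseˡ k = trans (cong (ℚ._* ι (suc k)) (ℚ.normalize-coprime (Coprime.1-coprimeTo (suc k))))
                         (ℚ.*-inverseˡ (ι (suc k)))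

-- A record rather than the bare equation, so that unification can read p off its type.
record Clears (N : ℕ) (p : ℚ) (m : ℕ) : Set where
  constructor clears
  field
    *ι≡ι : p ℚ.* ι N ≡ ι m

recip-clears : ∀ x {N} m → 0 <ₙ x → N ≡ x * m → Clears N (recip x) m
recip-clears (suc k) m _ refl = clears (begin
  recip (suc k) ℚ.* ι (suc k * m)        ≡⟨ cong (recip (suc k) ℚ.*_) (sym (ι-* (suc k) m)) ⟩
  recip (suc k) ℚ.* (ι (suc k) ℚ.* ι m)  ≡⟨ sym (ℚ.*-assoc (recip (suc k)) (ι (suc k)) (ι m)) ⟩
  recip (suc k) ℚ.* ι (suc k) ℚ.* ι m    ≡⟨ cong (ℚ._* ι m) (recip-inverseˡ k) ⟩
  1ℚ ℚ.* ι m                             ≡⟨ ℚ.*-identityˡ (ι m) ⟩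
  ι m                                    ∎)
  where open ≡-Reasoning

+-clears : ∀ {N p q m n} → Clears N p m → Clears N q n → Clears N (p ℚ.+ q) (m + n)
+-clears {N} {p} {q} {m} {n} (clears p≡) (clears q≡) =
  clears (trans (ℚ.*-distribʳ-+ (ι N) p q) (trans (cong₂ ℚ._+_ p≡ q≡) (ι-+ m n)))

clears-≤ : ∀ {p q m n} N → 0 <ₙ N → Clears N p m → Clears N q n → m ≤ₙ n → p ≤ q
clears-≤ (suc k) _ (clears p≡) (clears q≡) m≤n =
  ℚ.*-cancelʳ-≤-pos (ι (suc k)) (subst₂ _≤_ (sym p≡) (sym q≡) (ι-mono-≤ m≤n))

clears-< : ∀ {p q m n} N → 0 <ₙ N → Clears N p m → Clears N q n → m <ₙ n → p < q
clears-< (suc k) _ (clears p≡) (clears q≡) m<n =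
  ℚ.*-cancelʳ-<-nonNeg (ι (suc k)) (subst₂ _<_ (sym p≡) (sym q≡) (ι-mono-< m<n))

recip-nonneg : ∀ x → 0ℚ ≤ recip x
recip-nonneg zero    = ℚ.≤-refl
recip-nonneg (suc k) = ℚ.nonNegative⁻¹ (recip (suc k)) {{ℚ.normalize-nonNeg 1 (suc k)}}

recip-antimono-≤ : ∀ {x y} → 0 <ₙ y → y ≤ₙ x → recip x ≤ recip y
recip-antimono-≤ {x} {y} 0<y y≤x =
  clears-≤ (x * y) (ℕ.*-mono-< 0<x 0<y)
    (recip-clears x y 0<x refl) (recip-clears y x 0<y (ℕ.*-comm x y)) y≤x
  where
  0<x : 0 <ₙ x
  0<x = ℕ.<-≤-trans 0<y y≤x

recip-antimono-< : ∀ {x y} → 0 <ₙ y → y <ₙ x → recip x < recip y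
recip-antimono-< {x} {y} 0<y y<x =
  clears-< (x * y) (ℕ.*-mono-< 0<x 0<y)
    (recip-clears x y 0<x refl) (recip-clears y x 0<y (ℕ.*-comm x y)) y<x
  where
  0<x : 0 <ₙ x
  0<x = ℕ.<-trans 0<y y<x

recip-*suc+recip-suc≤recip : ∀ n → 0 <ₙ n → recip (n * suc n) ℚ.+ recip (suc n) ≤ recip n
recip-*suc+recip-suc≤recip n 0<n = clears-≤ (n * suc n) 0<N
  (+-clears (recip-clears (n * suc n) 1 0<N (sym (ℕ.*-identityʳ (n * suc n))))
            (recip-clears (suc n) n (s≤s z≤n) (ℕ.*-comm n (suc n))))
  (recip-clears n (suc n) 0<n refl)
  ℕ.≤-refl
  where
  0<N : 0 <ₙ n * suc n
  0<N = ℕ.*-mono-< 0<n (s≤s z≤n)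

recip-2*+recip-2*≤recip : ∀ n → 0 <ₙ n → recip (2 * n) ℚ.+ recip (2 * n) ≤ recip n
recip-2*+recip-2*≤recip n 0<n =
  clears-≤ (2 * n) 0<2n (+-clears half half) (recip-clears n 2 0<n (ℕ.*-comm 2 n)) ℕ.≤-refl
  where
  0<2n : 0 <ₙ 2 * n
  0<2n = ℕ.*-mono-< {0} {2} (s≤s z≤n) 0<n
  half : Clears (2 * n) (recip (2 * n)) 1
  half = recip-clears (2 * n) 1 0<2n (sym (ℕ.*-identityʳ (2 * n)))

stepwise-monotone : ∀ {a ℓ} {A : Set a} (_∼_ : Rel A ℓ) → Reflexive _∼_ → Transitive _∼_ →
                    (f : ℕ → A) → (∀ i → f i ∼ f (suc i)) → ∀ {m n} → m ≤ₙ n → f m ∼ f n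
stepwise-monotone _∼_ ∼-refl ∼-trans f step {m} m≤n = go (ℕ.≤⇒≤′ m≤n)
  where
  go : ∀ {n} → m ≤′ n → f m ∼ f n
  go ≤′-refl        = ∼-refl
  go (≤′-step m≤′n) = ∼-trans (go m≤′n) (step _)

partial-mono : ∀ b {m n} → m ≤ₙ n → partial b m ≤ partial b n
partial-mono b = stepwise-monotone _≤_ ℚ.≤-refl ℚ.≤-trans (partial b)
                                   (λ i → p≤p+q (partial b i) (recip-nonneg (b i)))

partial-tail-≤ : ∀ b (U : ℕ → ℚ) → (∀ i → recip (b i) ℚ.+ U (suc i) ≤ U i) →
                 (∀ i → 0ℚ ≤ U i) →
                 ∀ n k → partial b k - partial b n ≤ U n
partial-tail-≤ b U step U≥0 n k = p≤q+r⇒p-q≤r (partial-≤ (ℕ.≤-total n k))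
  where
  W : ℕ → ℚ
  W i = partial b i ℚ.+ U i

  W-step : ∀ i → W (suc i) ≤ W i
  W-step i = begin
    partial b i ℚ.+ recip (b i) ℚ.+ U (suc i)    ≡⟨ ℚ.+-assoc (partial b i) (recip (b i)) (U (suc i)) ⟩
    partial b i ℚ.+ (recip (b i) ℚ.+ U (suc i))  ≤⟨ ℚ.+-monoʳ-≤ (partial b i) (step i) ⟩
    partial b i ℚ.+ U i                          ∎
    where open ℚ.≤-Reasoning

  partial-≤ : n ≤ₙ k ⊎ k ≤ₙ n → partial b k ≤ partial b n ℚ.+ U n
  partial-≤ (inj₁ n≤k) = ℚ.≤-trans (p≤p+q (partial b k) (U≥0 k))
                                   (stepwise-monotone (flip _≤_) ℚ.≤-refl (flip ℚ.≤-trans) W W-step n≤k)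
  partial-≤ (inj₂ k≤n) = ℚ.≤-trans (partial-mono b k≤n) (p≤p+q (partial b n) (U≥0 n))

partial-tail-> : ∀ b (x ε : ℕ → ℚ) → (∀ i → x i ℚ.+ ε i ≤ recip (b i) ℚ.+ x (suc i)) →
                 (∀ i → 0ℚ ≤ ε i) →
                 ∀ {n k} → n <ₙ k → x k < ε n → x n < partial b k - partial b n
partial-tail-> b x ε step ε≥0 {n} {k} n<k xₖ<εₙ =
  p+q<r⇒q<r-p (partial b n) (+-cancelʳ-< {q = partial b k} (x k) (begin-strict
    Ψ n ℚ.+ x k  <⟨ ℚ.+-monoʳ-< (Ψ n) xₖ<εₙ ⟩
    Ψ n ℚ.+ ε n  ≤⟨ Ψ-step n ⟩
    Ψ (suc n)    ≤⟨ Ψ-mono n<k ⟩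
    Ψ k          ∎))
  where
  open ℚ.≤-Reasoning

  Ψ : ℕ → ℚ
  Ψ i = partial b i ℚ.+ x i

  Ψ-step : ∀ i → Ψ i ℚ.+ ε i ≤ Ψ (suc i)
  Ψ-step i = begin
    partial b i ℚ.+ x i ℚ.+ ε i                  ≡⟨ ℚ.+-assoc (partial b i) (x i) (ε i) ⟩
    partial b i ℚ.+ (x i ℚ.+ ε i)                ≤⟨ ℚ.+-monoʳ-≤ (partial b i) (step i) ⟩
    partial b i ℚ.+ (recip (b i) ℚ.+ x (suc i))  ≡⟨ sym (ℚ.+-assoc (partial b i) (recip (b i)) (x (suc i))) ⟩
    Ψ (suc i)                                    ∎

  Ψ-mono : ∀ {i j} → i ≤ₙ j → Ψ i ≤ Ψ j
  Ψ-mono = stepwise-monotone _≤_ ℚ.≤-refl ℚ.≤-trans Ψ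
                             (λ i → ℚ.≤-trans (p≤p+q (Ψ i) (ε≥0 i)) (Ψ-step i))

m<[1+m/n]*n : ∀ m n .{{_ : NonZero n}} → m <ₙ suc (m / n) * n
m<[1+m/n]*n m n =
  subst (_<ₙ n + m / n * n) (sym (m≡m%n+[m/n]*n m n)) (ℕ.+-monoˡ-< (m / n * n) (m%n<n m n))

threshold : ℕ → ℕ
threshold A = 2 * (A * suc A)

slack-root : ℕ → ℕ
slack-root A = A * (A + threshold A)

slack : ℕ → ℕ
slack A = slack-root A * slack-root A

budget : ℕ → ℕ → ℚ
budget A i = recip A - recip (slack A) ℚ.+ recip (suc i + slack A)

denominator : ℕ → ℕ → ℕ → ℕ
denominator A zero    i = (suc i + slack A) * suc (suc i + slack A)
denominator A (suc d) i = suc A + A * A / suc d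

module _ {A : ℕ} (0<A : 0 <ₙ A) where

  0<threshold : 0 <ₙ threshold A
  0<threshold = ℕ.*-mono-< {0} {2} (s≤s z≤n) (ℕ.*-mono-< 0<A (s≤s z≤n))

  0<slack-root : 0 <ₙ slack-root A
  0<slack-root = ℕ.*-mono-< 0<A (ℕ.<-≤-trans 0<A (ℕ.m≤m+n A (threshold A)))

  0<slack : 0 <ₙ slack A
  0<slack = ℕ.*-mono-< 0<slack-root 0<slack-root

  slack-root≤slack : slack-root A ≤ₙ slack A
  slack-root≤slack = ℕ.m≤m*n (slack-root A) (slack-root A) {{>-nonZero 0<slack-root}}

  A≤slack : A ≤ₙ slack A
  A≤slack = ℕ.≤-trans (ℕ.m≤m*n A (A + threshold A) {{>-nonZero (ℕ.<-≤-trans 0<A (ℕ.m≤m+n A _))}})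
                      slack-root≤slack

  threshold≤slack : threshold A ≤ₙ slack A
  threshold≤slack = ℕ.≤-trans (ℕ.m≤n+m (threshold A) A)
                    (ℕ.≤-trans (ℕ.m≤n*m (A + threshold A) A {{>-nonZero 0<A}}) slack-root≤slack)

  budget-nonneg : ∀ i → 0ℚ ≤ budget A i
  budget-nonneg i = ℚ.≤-trans (p+q≤r⇒q≤r-p 1/slack≤1/A) (p≤p+q _ (recip-nonneg (suc i + slack A)))
    where
    1/slack≤1/A : recip (slack A) ℚ.+ 0ℚ ≤ recip A
    1/slack≤1/A = subst (_≤ recip A) (sym (ℚ.+-identityʳ (recip (slack A))))
                        (recip-antimono-≤ 0<A A≤slack)

  budget<recip : ∀ i → budget A i < recip A
  budget<recip i = begin-strict
    R ℚ.+ recip (suc i + slack A)  <⟨ ℚ.+-monoʳ-< R 1/e<1/slack ⟩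
    R ℚ.+ recip (slack A)          ≡⟨ p-q+q≡p (recip A) (recip (slack A)) ⟩
    recip A                        ∎
    where
    open ℚ.≤-Reasoning
    R : ℚ
    R = recip A - recip (slack A)
    1/e<1/slack : recip (suc i + slack A) < recip (slack A)
    1/e<1/slack = recip-antimono-< 0<slack (ℕ.m<n+m (slack A) {suc i} (s≤s z≤n))

run-upper : ∀ A i → recip (denominator A 0 i) ℚ.+ budget A (suc i) ≤ budget A i
run-upper A i = begin
  recip (e * suc e) ℚ.+ (R ℚ.+ recip (suc e))  ≡⟨ p+[q+r]≡q+[p+r] (recip (e * suc e)) R (recip (suc e)) ⟩
  R ℚ.+ (recip (e * suc e) ℚ.+ recip (suc e))  ≤⟨ ℚ.+-monoʳ-≤ R (recip-*suc+recip-suc≤recip e (s≤s z≤n)) ⟩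
  R ℚ.+ recip e                                ∎
  where
  open ℚ.≤-Reasoning
  e : ℕ
  e = suc i + slack A
  R : ℚ
  R = recip A - recip (slack A)

-- q is ⌊A²/D⌋, given by its two defining inequalities.
module Jump {A D q : ℕ} (0<A : 0 <ₙ A) (0<D : 0 <ₙ D)
            (q*D≤A*A : q * D ≤ₙ A * A) (A*A<[1+q]*D : A * A <ₙ suc q * D) where

  b : ℕ
  b = suc A + q

  P : ℕ
  P = A * (A + D)

  0<A+D : 0 <ₙ A + D
  0<A+D = ℕ.<-≤-trans 0<A (ℕ.m≤m+n A D)

  jump-lower-cleared : b * suc (A + D) + 1 ≤ₙ suc A * suc (A + D) + b * suc A
  jump-lower-cleared = begin
    b * suc (A + D) + 1                            ≡⟨ e₁ A D q ⟩
    suc A * D + b * suc A + suc (q * D)            ≤⟨ ℕ.+-monoʳ-≤ (suc A * D + b * suc A) (s≤s q*D≤A*A) ⟩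
    suc A * D + b * suc A + suc (A * A)            ≤⟨ ℕ.+-monoʳ-≤ (suc A * D + b * suc A) (ℕ.m≤m+n _ (2 * A)) ⟩
    suc A * D + b * suc A + (suc (A * A) + 2 * A)  ≡⟨ e₂ A D q ⟩
    suc A * suc (A + D) + b * suc A                ∎
    where
    open ℕ.≤-Reasoning
    e₁ : ∀ A D q → (suc A + q) * suc (A + D) + 1 ≡ suc A * D + (suc A + q) * suc A + suc (q * D)
    e₁ = solve-∀ ℕ-ring
    e₂ : ∀ A D q → suc A * D + (suc A + q) * suc A + (suc (A * A) + 2 * A)
                   ≡ suc A * suc (A + D) + (suc A + q) * suc A
    e₂ = solve-∀ ℕ-ring

  jump-lower : recip (suc A) ℚ.+ recip (b * suc A * suc (A + D)) ≤ recip b ℚ.+ recip (suc (A + D))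
  jump-lower = clears-≤ N (>-nonZero⁻¹ N)
    (+-clears (recip-clears (suc A) (b * suc (A + D)) (s≤s z≤n) (xy·z≡y·xz b (suc A) (suc (A + D))))
              (recip-clears N 1 (>-nonZero⁻¹ N) (sym (ℕ.*-identityʳ N))))
    (+-clears (recip-clears b (suc A * suc (A + D)) (s≤s z≤n) (ℕ.*-assoc b (suc A) (suc (A + D))))
              (recip-clears (suc (A + D)) (b * suc A) (s≤s z≤n) (ℕ.*-comm (b * suc A) (suc (A + D)))))
    jump-lower-cleared
    where
    N : ℕ
    N = b * suc A * suc (A + D)
    xy·z≡y·xz : ∀ x y z → x * y * z ≡ y * (x * z)
    xy·z≡y·xz = solve-∀ ℕ-ring

  large-jump-margin : threshold A ≤ₙ D → recip (slack A) ℚ.+ (recip b ℚ.+ recip (A + D)) ≤ recip A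
  large-jump-margin K≤D = begin
    recip (slack A) ℚ.+ (recip b ℚ.+ recip (A + D))  ≤⟨ ℚ.+-mono-≤ 1/slack≤1/K
                                                          (ℚ.+-mono-≤ 1/b≤1/v 1/[A+D]≤1/K) ⟩
    recip K ℚ.+ (recip (suc A) ℚ.+ recip K)          ≡⟨ p+[q+r]≡q+[p+r] (recip K) (recip (suc A)) (recip K) ⟩
    recip (suc A) ℚ.+ (recip K ℚ.+ recip K)          ≤⟨ ℚ.+-monoʳ-≤ (recip (suc A)) 2/K≤1/[Av] ⟩
    recip (suc A) ℚ.+ recip (A * suc A)              ≡⟨ ℚ.+-comm (recip (suc A)) (recip (A * suc A)) ⟩
    recip (A * suc A) ℚ.+ recip (suc A)              ≤⟨ recip-*suc+recip-suc≤recip A 0<A ⟩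
    recip A                                          ∎
    where
    open ℚ.≤-Reasoning
    K : ℕ
    K = threshold A
    1/slack≤1/K : recip (slack A) ≤ recip K
    1/slack≤1/K = recip-antimono-≤ (0<threshold 0<A) (threshold≤slack 0<A)
    1/b≤1/v : recip b ≤ recip (suc A)
    1/b≤1/v = recip-antimono-≤ (s≤s z≤n) (ℕ.m≤m+n (suc A) q)
    1/[A+D]≤1/K : recip (A + D) ≤ recip K
    1/[A+D]≤1/K = recip-antimono-≤ (0<threshold 0<A) (ℕ.≤-trans K≤D (ℕ.m≤n+m D A))
    2/K≤1/[Av] : recip K ℚ.+ recip K ≤ recip (A * suc A)
    2/K≤1/[Av] = recip-2*+recip-2*≤recip (A * suc A) (ℕ.*-mono-< 0<A (s≤s z≤n))

  sucP≤b*D : suc P ≤ₙ b * D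
  sucP≤b*D = begin
    suc (A * (A + D))    ≡⟨ e₁ A D ⟩
    A * D + suc (A * A)  ≤⟨ ℕ.+-monoʳ-≤ (A * D) A*A<[1+q]*D ⟩
    A * D + suc q * D    ≡⟨ e₂ A D q ⟩
    b * D                ∎
    where
    open ℕ.≤-Reasoning
    e₁ : ∀ A D → suc (A * (A + D)) ≡ A * D + suc (A * A)
    e₁ = solve-∀ ℕ-ring
    e₂ : ∀ A D q → A * D + suc q * D ≡ (suc A + q) * D
    e₂ = solve-∀ ℕ-ring

  small-jump-cleared : b + (P * suc P + b * A * suc P) ≤ₙ b * (A + D) * suc P
  small-jump-cleared = begin
    b + (P * suc P + b * A * suc P)  ≡⟨ sym (ℕ.+-assoc b (P * suc P) (b * A * suc P)) ⟩
    b + P * suc P + b * A * suc P    ≤⟨ ℕ.+-monoˡ-≤ (b * A * suc P) b+P*sucP≤b*D*sucP ⟩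
    b * D * suc P + b * A * suc P    ≡⟨ distrib b A D (suc P) ⟩
    b * (A + D) * suc P              ∎
    where
    open ℕ.≤-Reasoning
    b+P*sucP≤b*D*sucP : b + P * suc P ≤ₙ b * D * suc P
    b+P*sucP≤b*D*sucP = begin
      b + P * suc P      ≤⟨ ℕ.+-mono-≤ (ℕ.m≤m*n b D {{>-nonZero 0<D}})
                                         (ℕ.≤-reflexive (ℕ.*-comm P (suc P))) ⟩
      b * D + suc P * P  ≤⟨ ℕ.+-monoʳ-≤ (b * D) (ℕ.*-monoˡ-≤ P sucP≤b*D) ⟩
      b * D + b * D * P  ≡⟨ sym (ℕ.*-suc (b * D) P) ⟩
      b * D * suc P      ∎
    distrib : ∀ b x y s → b * y * s + b * x * s ≡ b * (x + y) * s
    distrib = solve-∀ ℕ-ring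

  small-jump-margin : D <ₙ threshold A → recip (slack A) ℚ.+ (recip b ℚ.+ recip (A + D)) ≤ recip A
  small-jump-margin D<K = begin
    recip (slack A) ℚ.+ R    ≤⟨ ℚ.+-monoˡ-≤ R 1/slack≤1/P[P+1] ⟩
    recip (P * suc P) ℚ.+ R  ≤⟨ clears-≤ N 0<N (+-clears c₁ (+-clears c₂ c₃)) c₄ small-jump-cleared ⟩
    recip A                  ∎
    where
    open ℚ.≤-Reasoning
    R : ℚ
    R = recip b ℚ.+ recip (A + D)
    N : ℕ
    N = b * (P * suc P)
    0<P*sucP : 0 <ₙ P * suc P
    0<P*sucP = ℕ.*-mono-< (ℕ.*-mono-< 0<A 0<A+D) (s≤s z≤n)
    0<N : 0 <ₙ N
    0<N = ℕ.*-mono-< {0} {b} (s≤s z≤n) 0<P*sucP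
    P<slack-root : P <ₙ slack-root A
    P<slack-root = ℕ.*-monoʳ-< A {{>-nonZero 0<A}} (ℕ.+-monoʳ-< A D<K)
    1/slack≤1/P[P+1] : recip (slack A) ≤ recip (P * suc P)
    1/slack≤1/P[P+1] = recip-antimono-≤ 0<P*sucP (ℕ.*-mono-≤ (ℕ.<⇒≤ P<slack-root) P<slack-root)
    b·xys≡y·bxs : ∀ b x y s → b * (x * y * s) ≡ y * (b * x * s)
    b·xys≡y·bxs = solve-∀ ℕ-ring
    b·xys≡x·bys : ∀ b x y s → b * (x * y * s) ≡ x * (b * y * s)
    b·xys≡x·bys = solve-∀ ℕ-ring
    c₁ : Clears N (recip (P * suc P)) b
    c₁ = recip-clears (P * suc P) b 0<P*sucP (ℕ.*-comm b (P * suc P))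
    c₂ : Clears N (recip b) (P * suc P)
    c₂ = recip-clears b (P * suc P) (s≤s z≤n) refl
    c₃ : Clears N (recip (A + D)) (b * A * suc P)
    c₃ = recip-clears (A + D) (b * A * suc P) 0<A+D (b·xys≡y·bxs b A (A + D) (suc P))
    c₄ : Clears N (recip A) (b * (A + D) * suc P)
    c₄ = recip-clears A (b * (A + D) * suc P) 0<A (b·xys≡x·bys b A (A + D) (suc P))

  jump-upper : ∀ i → recip b ℚ.+ budget (A + D) (suc i) ≤ budget A i
  jump-upper i = begin
    recip b ℚ.+ budget (A + D) (suc i)  ≤⟨ ℚ.+-monoʳ-≤ (recip b) (ℚ.<⇒≤ (budget<recip 0<A+D (suc i))) ⟩
    recip b ℚ.+ recip (A + D)           ≤⟨ p+q≤r⇒q≤r-p margin ⟩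
    recip A - recip (slack A)           ≤⟨ p≤p+q (recip A - recip (slack A)) (recip-nonneg (suc i + slack A)) ⟩
    budget A i                          ∎
    where
    open ℚ.≤-Reasoning
    margin : recip (slack A) ℚ.+ (recip b ℚ.+ recip (A + D)) ≤ recip A
    margin with ℕ.≤-<-connex (threshold A) D
    ... | inj₁ K≤D = large-jump-margin K≤D
    ... | inj₂ D<K = small-jump-margin D<K

module DivJump {A : ℕ} (0<A : 0 <ₙ A) (d : ℕ) =
  Jump {A} {suc d} {A * A / suc d} 0<A (s≤s z≤n) (m/n*n≤m (A * A) (suc d)) (m<[1+m/n]*n (A * A) (suc d))

denominator-pos : ∀ A D i → 0 <ₙ denominator A D i
denominator-pos A zero    i = ℕ.*-mono-< {0} {suc i + slack A} (s≤s z≤n) (s≤s z≤n)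
denominator-pos A (suc d) i = s≤s z≤n

denominator-upper : ∀ {A} → 0 <ₙ A → ∀ D i →
                    recip (denominator A D i) ℚ.+ budget (A + D) (suc i) ≤ budget A i
denominator-upper {A} 0<A zero    i rewrite ℕ.+-identityʳ A = run-upper A i
denominator-upper     0<A (suc d) i = DivJump.jump-upper 0<A d i

denominator-lower : ∀ {A} → 0 <ₙ A → ∀ D i →
                    recip (suc A) ℚ.+ recip (denominator A D i * suc A * suc (A + D))
                    ≤ recip (denominator A D i) ℚ.+ recip (suc (A + D))
denominator-lower {A} 0<A zero i rewrite ℕ.+-identityʳ A = begin
  recip (suc A) ℚ.+ recip (b * suc A * suc A)  ≤⟨ ℚ.+-monoʳ-≤ (recip (suc A))
                                                    (recip-antimono-≤ (denominator-pos A 0 i) b≤b*v*v) ⟩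
  recip (suc A) ℚ.+ recip b                    ≡⟨ ℚ.+-comm (recip (suc A)) (recip b) ⟩
  recip b ℚ.+ recip (suc A)                    ∎
  where
  open ℚ.≤-Reasoning
  b : ℕ
  b = denominator A 0 i
  b≤b*v*v : b ≤ₙ b * suc A * suc A
  b≤b*v*v = ℕ.≤-trans (ℕ.m≤m*n b (suc A)) (ℕ.m≤m*n (b * suc A) (suc A))
denominator-lower 0<A (suc d) i = DivJump.jump-lower 0<A d

transition-upper : ∀ {v w} i → 2 ≤ₙ v → v ≤ₙ w →
                   recip (denominator (v ∸ 1) (w ∸ v) i) ℚ.+ budget (w ∸ 1) (suc i) ≤ budget (v ∸ 1) i
transition-upper {suc A} i (s≤s 0<A) v≤w with ℕ.m≤n⇒∃[o]m+o≡n v≤w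
... | D , refl rewrite ℕ.m+n∸m≡n (suc A) D = denominator-upper 0<A D i

transition-lower : ∀ {v w} i → 2 ≤ₙ v → v ≤ₙ w →
                   recip v ℚ.+ recip (denominator (v ∸ 1) (w ∸ v) i * v * w)
                   ≤ recip (denominator (v ∸ 1) (w ∸ v) i) ℚ.+ recip w
transition-lower {suc A} i (s≤s 0<A) v≤w with ℕ.m≤n⇒∃[o]m+o≡n v≤w
... | D , refl rewrite ℕ.m+n∸m≡n (suc A) D = denominator-lower 0<A D i

module Construction (a : ℕ → ℕ) (a-pos : ∀ n → 0 <ₙ a n) (a-step : ∀ n → a n ≤ₙ a (suc n))
                    (a₀≥2 : 2 ≤ₙ a 0) (a-unbounded : ∀ M → ∃ λ N → M ≤ₙ a N) where

  a-mono : ∀ {m n} → m ≤ₙ n → a m ≤ₙ a n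
  a-mono = stepwise-monotone _≤ₙ_ ℕ.≤-refl ℕ.≤-trans a a-step

  a≥2 : ∀ n → 2 ≤ₙ a n
  a≥2 n = ℕ.≤-trans a₀≥2 (a-mono z≤n)

  0<a∸1 : ∀ n → 0 <ₙ a n ∸ 1
  0<a∸1 n = ℕ.∸-monoˡ-≤ 1 (a≥2 n)

  b : ℕ → ℕ
  b i = denominator (a i ∸ 1) (a (suc i) ∸ a i) i

  b-pos : ∀ i → 0 <ₙ b i
  b-pos i = denominator-pos (a i ∸ 1) (a (suc i) ∸ a i) i

  U : ℕ → ℚ
  U i = budget (a i ∸ 1) i

  gain : ℕ → ℕ
  gain i = b i * a i * a (suc i)

  tail-≤ : ∀ n k → partial b k - partial b n ≤ U n
  tail-≤ = partial-tail-≤ b U (λ i → transition-upper i (a≥2 i) (a-step i))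
                             (λ i → budget-nonneg (0<a∸1 i) i)

  U≤recip : ∀ n → U n ≤ recip (a n ∸ 1)
  U≤recip n = ℚ.<⇒≤ (budget<recip (0<a∸1 n) n)

  tail-> : ∀ n → ∃ λ k → recip (a n) < partial b k - partial b n
  tail-> n with a-unbounded (suc (gain n))
  ... | N , gainₙ<a = suc n + N ,
    partial-tail-> b (λ i → recip (a i)) (λ i → recip (gain i)) (λ i → transition-lower i (a≥2 i) (a-step i))
                   (λ i → recip-nonneg (gain i)) (ℕ.m≤m+n (suc n) N)
                   (recip-antimono-< (ℕ.*-mono-< (ℕ.*-mono-< (b-pos n) (a-pos n)) (a-pos (suc n)))
                                     (ℕ.<-≤-trans gainₙ<a (a-mono (ℕ.m≤n+m N (suc n)))))

  partial-positive : ∃ λ k → 0ℚ < partial b k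
  partial-positive with tail-> 0
  ... | k , 1/a₀<Sₖ =
    k , ℚ.≤-<-trans (recip-nonneg (a 0)) (subst (recip (a 0) <_) (ℚ.+-identityʳ (partial b k)) 1/a₀<Sₖ)

  -- recip 1 computes to 1ℚ.
  U₀<1 : U 0 < 1ℚ
  U₀<1 = ℚ.<-≤-trans (budget<recip (0<a∸1 0) 0) (recip-antimono-≤ (s≤s z≤n) (0<a∸1 0))

  partial≤U₀ : ∀ k → partial b k ≤ U 0
  partial≤U₀ k = subst (_≤ U 0) (ℚ.+-identityʳ (partial b k)) (tail-≤ 0 k)

theorem1 : (a : ℕ → ℕ)
    → (∀ n → 0 <ₙ a n)
    → (∀ n → a n ≤ₙ a (Data.Nat.suc n))
    → 2 ≤ₙ a 0
    → (∀ M → ∃ λ N → M ≤ₙ a N)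
    → ∃ λ (b : ℕ → ℕ)
        → (∀ n → 0 <ₙ b n)
          × (∃ λ k → 0ℚ < partial b k)
          × (∃ λ q → q < 1ℚ × (∀ k → partial b k ≤ q))
          × (∀ n →
               (∀ k → (partial b k - partial b n) ≤ recip (a n ∸ 1))
               × (∃ λ k → recip (a n) < (partial b k - partial b n)))
theorem1 a a-pos a-step a₀≥2 a-unbounded =
  b , b-pos , partial-positive , (U 0 , U₀<1 , partial≤U₀) ,
  λ n → (λ k → ℚ.≤-trans (tail-≤ n k) (U≤recip n)) , tail-> n
  where open Construction a a-pos a-step a₀≥2 a-unbounded
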